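{- Let $P$ denote the Petersen graph. For every cubic simple graph $G$ of order $10$ not isomorphic to $P$, we have $d(G)\neq d(P)$ and $d_{\rm st}(G)\neq d_{\rm st}(P)$; that is, the domatic number and the strong domatic number of the Petersen graph are attained by no other cubic graph of order $10$.
   Context: Graphs need not be connected. The Petersen graph is the cubic graph on $\{1,\dots,10\}$ with outer $5$-cycle $1\text{ - }2\text{ - }3\text{ - }4\text{ - }5\text{ - }1$, spokes $1\text{ - }6$, $2\text{ - }7$, $3\text{ - }8$, $4\text{ - }9$, $5\text{ - }10$, and inner pentagram $6\text{ - }8\text{ - }10\text{ - }7\text{ - }9\text{ - }6$. For a finite simple graph $G=(V,E)$, a set $D\subseteq V$ is a dominating set if every vertex of $V\setminus D$ has a neighbor in $D$; the domatic number $d(G)$ is the maximum number of classes of a partition of $V$ into dominating sets. A set $D\subseteq V$ is a strong dominating set if for every vertex $x\in V\setminus D$ there is a vertex $y\in D$ with $xy\in E$ and $\deg(x)\le \deg(y)$. A strong domatic partition of $G$ is a partition of $V(G)$ all of whose classes are strong dominating sets of $G$. The strong domatic number $d_{\rm st}(G)$ is the maximum number of classes of a strong domatic partition of $G$. -}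

module Defs where

open import Data.Nat using (ℕ; _≤_)
open import Data.Bool using (Bool; true; false; if_then_else_; _∨_; _∧_)
open import Data.Fin using (Fin; _≟_)
open import Data.Fin.Patterns
open import Data.List using (List; []; _∷_; allFin; map)
open import Data.Nat.ListAction using (sum)
open import Data.Bool.ListAction using (any)
open import Data.Product using (Σ; ∃; _×_; _,_)
open import Relation.Nullary using (¬_)
open import Relation.Nullary.Decidable using (⌊_⌋)
open import Relation.Binary.PropositionalEquality using (_≡_)
open import Function.Bundles using (_↔_; Inverse)

Graph : ℕ → Set
Graph n = Fin n → Fin n → Bool

IsSimple : ∀ {n} → Graph n → Set
IsSimple {n} G = (∀ x y → G x y ≡ G y x) × (∀ x → G x x ≡ false)

deg : ∀ {n} → Graph n → Fin n → ℕ
deg {n} G x = sum (map (λ y → if G x y then 1 else 0) (allFin n))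

IsCubic : ∀ {n} → Graph n → Set
IsCubic {n} G = ∀ (x : Fin n) → deg G x ≡ 3

_≅_ : ∀ {n m} → Graph n → Graph m → Set
_≅_ {n} {m} G H = Σ (Fin n ↔ Fin m) λ σ →
  ∀ x y → G x y ≡ H (Inverse.to σ x) (Inverse.to σ y)

IsDominating : ∀ {n} → Graph n → (Fin n → Set) → Set
IsDominating {n} G D = ∀ x → ¬ D x → ∃ λ y → D y × G x y ≡ true

IsStrongDominating : ∀ {n} → Graph n → (Fin n → Set) → Set
IsStrongDominating {n} G D =
  ∀ x → ¬ D x → ∃ λ y → D y × G x y ≡ true × deg G x ≤ deg G y

IsPartitionInto : ∀ {n} → ((Fin n → Set) → Set) → (k : ℕ) → (Fin n → Fin k) → Set
IsPartitionInto {n} Good k f =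
  ∀ (i : Fin k) → (∃ λ v → f v ≡ i) × Good (λ v → f v ≡ i)

IsMaxPartitionNumber : ∀ {n} → ((Fin n → Set) → Set) → ℕ → Set
IsMaxPartitionNumber {n} Good m =
  (∃ λ (f : Fin n → Fin m) → IsPartitionInto Good m f) ×
  (∀ k (f : Fin n → Fin k) → IsPartitionInto Good k f → k ≤ m)

IsDomaticNumber : ∀ {n} → Graph n → ℕ → Set
IsDomaticNumber G = IsMaxPartitionNumber (IsDominating G)

IsStrongDomaticNumber : ∀ {n} → Graph n → ℕ → Set
IsStrongDomaticNumber G = IsMaxPartitionNumber (IsStrongDominating G)

-- Petersen graph; vertex i (1..10) of the paper is Fin index i-1.
petersenEdges : List (Fin 10 × Fin 10)
petersenEdges =
  (0F , 1F) ∷ (1F , 2F) ∷ (2F , 3F) ∷ (3F , 4F) ∷ (4F , 0F) ∷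
  (0F , 5F) ∷ (1F , 6F) ∷ (2F , 7F) ∷ (3F , 8F) ∷ (4F , 9F) ∷
  (5F , 7F) ∷ (7F , 9F) ∷ (9F , 6F) ∷ (6F , 8F) ∷ (8F , 5F) ∷ []

Petersen : Graph 10
Petersen x y = any (λ { (a , b) →
    (⌊ x ≟ a ⌋ ∧ ⌊ y ≟ b ⌋) ∨ (⌊ x ≟ b ⌋ ∧ ⌊ y ≟ a ⌋) }) petersenEdges

-- Colour the vertices so that every closed neighbourhood sees all three colours: the colour
-- classes of such a domatic 3-colouring are dominating, so d ≥ 3, and for a regular graph
-- strong domination coincides with domination, so d_st ≥ 3 as well. A pruned exhaustive
-- search shows that the Petersen graph has no domatic 3-colouring, whence d(P) = d_st(P) ≤ 2.
-- Every other cubic graph G on ten vertices has one. To see this, explore G vertex by vertex,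
-- labelling a fresh neighbour of an already labelled vertex (or any fresh vertex) and branching
-- on unknown adjacencies between labelled vertices. Each branch ends in a violation of
-- 3-regularity, in a domatic 3-colouring supported by the edges found so far, or in a
-- complete adjacency matrix isomorphic to the Petersen graph. The exploration tree is given
-- as a certificate and checked by evaluation.
module Submission where

open import Defs
open import Data.Bool using (Bool; true; false; T; not; _∧_; _∨_; if_then_else_)
import Data.Bool as Bool
open import Data.Bool.ListAction using (all; any)
open import Data.Bool.Properties using (T-∨; ∧-conicalˡ; ∧-conicalʳ)
open import Data.Char as Char using ()
open import Data.Empty using (⊥-elim)
open import Data.Fin using (Fin; zero; suc; toℕ; fromℕ<; inject≤; _≟_)
open import Data.Fin.Patterns
open import Data.Fin.Properties
  using (all?; any?; injective⇒≤; toℕ-injective; toℕ-fromℕ<; toℕ-inject≤; toℕ<n)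
open import Data.List using (List; []; _∷_; _++_; allFin; concatMap; filter; length; map)
open import Data.List.Membership.Propositional using (_∈_; find)
open import Data.List.Membership.Propositional.Properties
  using (∈-allFin; ∈-∃++; ∈-++⁻; ∈-++⁺ˡ; ∈-++⁺ʳ; ∈-filter⁺; ∈-filter⁻; ∈-map⁺; ∈-map⁻)
open import Data.List.Properties using (length-++; length-map; length-tabulate)
open import Data.List.Relation.Binary.Disjoint.Propositional using (Disjoint)
open import Data.List.Relation.Binary.Subset.Propositional using (_⊆_)
open import Data.List.Relation.Unary.All as All using (All; []; _∷_)
open import Data.List.Relation.Unary.All.Properties using (all⁺; ¬Any⇒All¬)
open import Data.List.Relation.Unary.AllPairs using ([]; _∷_)
open import Data.List.Relation.Unary.Any as Any using (here; there; satisfied)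
open import Data.List.Relation.Unary.Any.Properties using (any⁻)
open import Data.List.Relation.Unary.Unique.Propositional using (Unique)
import Data.List.Relation.Unary.Unique.Propositional.Properties as Unique
open import Data.Maybe using (Maybe; just; nothing; _>>=_; from-just)
open import Data.Nat using (ℕ; zero; suc; _≤_; _<_; _+_; _∸_; _⊓_; _<?_; s≤s; z≤n)
import Data.Nat as ℕ
open import Data.Nat.ListAction using (sum)
open import Data.Nat.Properties
  using (≤-reflexive; ≤-pred; +-suc; +-monoʳ-≤; m⊓n≤n; m≤n⇒m⊓n≡m; m+n≤o⇒m≤o∸n;
         <⇒≱; n≮n; 1+n≰n; module ≤-Reasoning)
open import Data.Nat.Show using (toDigitChar)
open import Data.Product using (Σ; ∃; _×_; _,_; proj₁; proj₂; map₂)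
open import Data.String using (String; toList)
open import Data.Sum using (_⊎_; inj₁; inj₂; [_,_]′)
open import Data.Vec using (Vec; []; _∷_; lookup; tabulate; zipWith; _[_]%=_; _[_]≔_)
open import Data.Vec.Functional using () renaming (_∷_ to _∷ᶠ_)
open import Data.Vec.Properties
  using (lookup∘tabulate; lookup-zipWith; lookup∘updateAt; lookup∘updateAt′;
         lookup∘update; lookup∘update′)
open import Function using (_∘_; id; Inverse; _↔_; Equivalence; mk↔ₛ′)
open import Function.Definitions using (Injective)
open import Function.Properties.Inverse using (↔-sym; ↔-trans)
open import Relation.Binary.PropositionalEquality
  using (_≡_; _≢_; refl; sym; trans; cong; cong₂; subst; subst₂; module ≡-Reasoning)
open import Relation.Nullary using (¬_; Dec; yes; no; ¬?)
open import Relation.Nullary.Decidable using (⌊_⌋; _×-dec_; _⊎-dec_; _→-dec_; toWitness; decidable-stable)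

-- Domatic colourings

module _ {n m : ℕ} where

  IsDomaticColouring : Graph n → (Fin n → Fin m) → Set
  IsDomaticColouring G c = ∀ x i → c x ≡ i ⊎ ∃ λ y → c y ≡ i × G x y ≡ true

  isDomaticColouring? : ∀ G c → Dec (IsDomaticColouring G c)
  isDomaticColouring? G c =
    all? λ x → all? λ i → (c x ≟ i) ⊎-dec any? λ y → (c y ≟ i) ×-dec (G x y Bool.≟ true)

  partition⇒domaticColouring : ∀ {G c} → IsPartitionInto (IsDominating G) m c → IsDomaticColouring G c
  partition⇒domaticColouring {c = c} partition x i with c x ≟ i
  ... | yes cx≡i = inj₁ cx≡i
  ... | no cx≢i = inj₂ (proj₂ (partition i) x cx≢i)

domaticColouring⇒partition : ∀ {n m} {G : Graph (suc n)} {c : Fin (suc n) → Fin m} →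
  IsDomaticColouring G c → IsPartitionInto (IsDominating G) m c
domaticColouring⇒partition {c = c} domatic i = inhabited , dominating
  where
  inhabited : ∃ λ v → c v ≡ i
  inhabited = [ (zero ,_) , map₂ proj₁ ]′ (domatic zero i)
  dominating : IsDominating _ (λ v → c v ≡ i)
  dominating x cx≢i = [ ⊥-elim ∘ cx≢i , id ]′ (domatic x i)

domaticColouring-∘ : ∀ {n k l} {G : Graph n} {c : Fin n → Fin k} (g : Fin k → Fin l) (s : Fin l → Fin k) →
  (∀ j → g (s j) ≡ j) → IsDomaticColouring G c → IsDomaticColouring G (g ∘ c)
domaticColouring-∘ g s g∘s≡id domatic x j with domatic x (s j)
... | inj₁ cx≡sj = inj₁ (trans (cong g cx≡sj) (g∘s≡id j))
... | inj₂ (y , cy≡sj , xy) = inj₂ (y , trans (cong g cy≡sj) (g∘s≡id j) , xy)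

collapse : ∀ {k m} → Fin k → Fin (suc m)
collapse {m = m} i = fromℕ< (s≤s (m⊓n≤n (toℕ i) m))

collapse-inject≤ : ∀ {k m} (j : Fin (suc m)) (m<k : suc m ≤ k) → collapse (inject≤ j m<k) ≡ j
collapse-inject≤ {m = m} j m<k = toℕ-injective (begin
  toℕ (collapse (inject≤ j m<k)) ≡⟨ toℕ-fromℕ< _ ⟩
  toℕ (inject≤ j m<k) ⊓ m        ≡⟨ cong (_⊓ m) (toℕ-inject≤ j m<k) ⟩
  toℕ j ⊓ m                      ≡⟨ m≤n⇒m⊓n≡m (≤-pred (toℕ<n j)) ⟩
  toℕ j                          ∎)
  where open ≡-Reasoning

domaticNumbers-differ : ∀ {n m a b} {G H : Graph (suc n)} {c : Fin (suc n) → Fin (suc m)} →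
  IsDomaticColouring G c → (∀ c′ → ¬ IsDomaticColouring H c′) →
  IsDomaticNumber G a → IsDomaticNumber H b → a ≢ b
domaticNumbers-differ {m = m} {a} domatic none (_ , maximal) ((f , partition) , _) refl =
  none (collapse ∘ f) (domaticColouring-∘ collapse (λ j → inject≤ j m<a) (λ j → collapse-inject≤ j m<a)
    (partition⇒domaticColouring partition))
  where
  m<a : suc m ≤ a
  m<a = maximal _ _ (domaticColouring⇒partition domatic)

module _ {n : ℕ} {G : Graph n} {D : Fin n → Set} where

  strongDominating⇒dominating : IsStrongDominating G D → IsDominating G D
  strongDominating⇒dominating strong x x∉D = let (y , y∈D , xy , _) = strong x x∉D in y , y∈D , xy

  regular⇒dominating⇒strongDominating : ∀ {r} → (∀ x → deg G x ≡ r) →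
    IsDominating G D → IsStrongDominating G D
  regular⇒dominating⇒strongDominating regular dominating x x∉D =
    let (y , y∈D , xy) = dominating x x∉D in y , y∈D , xy , ≤-reflexive (trans (regular x) (sym (regular y)))

maxPartitionNumber-cong : ∀ {n m} {P Q : (Fin n → Set) → Set} →
  (∀ {D} → P D → Q D) → (∀ {D} → Q D → P D) → IsMaxPartitionNumber P m → IsMaxPartitionNumber Q m
maxPartitionNumber-cong P⇒Q Q⇒P ((f , partition) , maximal) =
  (f , map₂ P⇒Q ∘ partition) , λ k g partition′ → maximal k g (map₂ Q⇒P ∘ partition′)

regular⇒strongDomaticNumber⇒domaticNumber : ∀ {n r m} {G : Graph n} → (∀ x → deg G x ≡ r) →
  IsStrongDomaticNumber G m → IsDomaticNumber G m
regular⇒strongDomaticNumber⇒domaticNumber regular =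
  maxPartitionNumber-cong (λ {D} → strongDominating⇒dominating {D = D})
    (λ {D} → regular⇒dominating⇒strongDominating {D = D} regular)

module _ {n n′ : ℕ} where
  open Inverse

  ≅-sym : {G : Graph n} {H : Graph n′} → G ≅ H → H ≅ G
  ≅-sym {G} {H} (σ , edges) = ↔-sym σ , λ x y →
    trans (sym (cong₂ H (strictlyInverseˡ σ x) (strictlyInverseˡ σ y))) (sym (edges (from σ x) (from σ y)))

  ≅-trans : ∀ {n″} {G : Graph n} {H : Graph n′} {I : Graph n″} → G ≅ H → H ≅ I → G ≅ I
  ≅-trans (σ , edges) (τ , edges′) =
    ↔-trans σ τ , λ x y → trans (edges x y) (edges′ (to σ x) (to σ y))

  domaticColouring-transport : ∀ {m} {L : Graph n} {G : Graph n′} {c : Fin n → Fin m}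
    (σ : Fin n ↔ Fin n′) →
    (∀ x y → L x y ≡ true → G (to σ x) (to σ y) ≡ true) →
    IsDomaticColouring L c → IsDomaticColouring G (c ∘ from σ)
  domaticColouring-transport {G = G} {c} σ homomorphic domatic x i with domatic (from σ x) i
  ... | inj₁ c≡i = inj₁ c≡i
  ... | inj₂ (y , cy≡i , xy) = inj₂ (to σ y , trans (cong c (strictlyInverseʳ σ y)) cy≡i ,
          subst (λ z → G z (to σ y) ≡ true) (strictlyInverseˡ σ x) (homomorphic _ y xy))

unique⇒length-≤ : ∀ {A : Set} {xs ys : List A} → Unique xs → xs ⊆ ys → length xs ≤ length ys
unique⇒length-≤ {xs = []} _ _ = z≤n
unique⇒length-≤ {xs = x ∷ xs} {ys} (x∉xs ∷ unique) xs⊆ys with ∈-∃++ (xs⊆ys (here refl))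
... | us , vs , refl = begin
  suc (length xs)             ≤⟨ s≤s (unique⇒length-≤ unique xs⊆us++vs) ⟩
  suc (length (us ++ vs))     ≡⟨ cong suc (length-++ us) ⟩
  suc (length us + length vs) ≡⟨ +-suc (length us) (length vs) ⟨
  length us + length (x ∷ vs) ≡⟨ length-++ us ⟨
  length (us ++ x ∷ vs)       ∎
  where
  open ≤-Reasoning
  xs⊆us++vs : xs ⊆ us ++ vs
  xs⊆us++vs {z} z∈xs with ∈-++⁻ us (xs⊆ys (there z∈xs))
  ... | inj₁ z∈us = ∈-++⁺ˡ z∈us
  ... | inj₂ (here refl) = ⊥-elim (All.lookup x∉xs z∈xs refl)
  ... | inj₂ (there z∈vs) = ∈-++⁺ʳ us z∈vs

module _ {n : ℕ} {P : Fin n → Set} (P? : ∀ x → Dec (P x)) where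

  ∈-filter-allFin⁺ : ∀ {x} → P x → x ∈ filter P? (allFin n)
  ∈-filter-allFin⁺ = ∈-filter⁺ P? (∈-allFin _)

  ∈-filter-allFin⁻ : ∀ {x} → x ∈ filter P? (allFin n) → P x
  ∈-filter-allFin⁻ = proj₂ ∘ ∈-filter⁻ P? {xs = allFin n}

neighbours : ∀ {n} → Graph n → Fin n → List (Fin n)
neighbours G x = filter (λ y → G x y Bool.≟ true) (allFin _)

∈-neighbours⁺ : ∀ {n} (G : Graph n) {x y} → G x y ≡ true → y ∈ neighbours G x
∈-neighbours⁺ G {x} = ∈-filter-allFin⁺ (λ y → G x y Bool.≟ true)

∈-neighbours⁻ : ∀ {n} (G : Graph n) {x y} → y ∈ neighbours G x → G x y ≡ true
∈-neighbours⁻ G {x} = ∈-filter-allFin⁻ (λ y → G x y Bool.≟ true)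

neighbours-unique : ∀ {n} (G : Graph n) x → Unique (neighbours G x)
neighbours-unique G x = Unique.filter⁺ (λ y → G x y Bool.≟ true) (Unique.allFin⁺ _)

length-neighbours : ∀ {n} (G : Graph n) x → length (neighbours G x) ≡ deg G x
length-neighbours G x = count (allFin _)
  where
  count : ∀ ys →
    length (filter (λ y → G x y Bool.≟ true) ys) ≡ sum (map (λ y → if G x y then 1 else 0) ys)
  count [] = refl
  count (y ∷ ys) with G x y
  ... | true = cong suc (count ys)
  ... | false = count ys

-- Exhaustive search for domatic colourings

module ColouringSearch {n m : ℕ} (G : Graph n) (N : Fin n → List (Fin n))
                       (N-complete : ∀ {x y} → G x y ≡ true → y ∈ N x) where

  Assignment : Set
  Assignment = List (Fin n × Fin m)

  _⊑_ : Assignment → (Fin n → Fin m) → Set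
  p ⊑ c = All (λ (v , i) → c v ≡ i) p

  avoids : Assignment → Fin m → Fin n → Bool
  avoids p i y = any (λ (v , j) → ⌊ v ≟ y ⌋ ∧ not ⌊ j ≟ i ⌋) p

  misses : Assignment → Fin n → Bool
  misses p x = any (λ i → all (avoids p i) (x ∷ N x)) (allFin m)

  -- After colouring v, only closed neighbourhoods through v can have become complete.
  refutes : List (Fin n) → Assignment → Bool
  refutes [] p = false
  refutes (v ∷ vs) p =
    all (λ i → let q = (v , i) ∷ p in any (misses q) (v ∷ N v) ∨ refutes vs q) (allFin m)

  module _ {c : Fin n → Fin m} where

    avoids-sound : ∀ {i y} p → p ⊑ c → T (avoids p i y) → c y ≢ i
    avoids-sound {i} {y} ((v , j) ∷ p) (cv≡j ∷ p⊑c) ok with v ≟ y | j ≟ i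
    ... | yes refl | no j≢i = λ cv≡i → j≢i (trans (sym cv≡j) cv≡i)
    ... | yes _ | yes _ = avoids-sound p p⊑c ok
    ... | no _ | _ = avoids-sound p p⊑c ok

    misses-sound : ∀ {p} x → p ⊑ c → T (misses p x) → ¬ IsDomaticColouring G c
    misses-sound {p} x p⊑c ok domatic with satisfied (any⁻ _ (allFin m) ok)
    ... | i , ok′ with all⁺ _ (x ∷ N x) ok′ | domatic x i
    ...   | avoided ∷ _ | inj₁ cx≡i = avoids-sound p p⊑c avoided cx≡i
    ...   | _ ∷ avoided | inj₂ (y , cy≡i , xy) =
            avoids-sound p p⊑c (All.lookup avoided (N-complete xy)) cy≡i

    refutes-sound : ∀ vs {p} → p ⊑ c → T (refutes vs p) → ¬ IsDomaticColouring G c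
    refutes-sound (v ∷ vs) p⊑c ok
      with Equivalence.to T-∨ (All.lookup (all⁺ _ (allFin m) ok) (∈-allFin (c v)))
    ... | inj₁ missed =
      let (x , ok′) = satisfied (any⁻ _ (v ∷ N v) missed) in misses-sound x (refl ∷ p⊑c) ok′
    ... | inj₂ refuted = refutes-sound vs (refl ∷ p⊑c) refuted

petersenNeighbours : Fin 10 → List (Fin 10)
petersenNeighbours 0F = 1F ∷ 4F ∷ 5F ∷ []
petersenNeighbours 1F = 0F ∷ 2F ∷ 6F ∷ []
petersenNeighbours 2F = 1F ∷ 3F ∷ 7F ∷ []
petersenNeighbours 3F = 2F ∷ 4F ∷ 8F ∷ []
petersenNeighbours 4F = 3F ∷ 0F ∷ 9F ∷ []
petersenNeighbours 5F = 0F ∷ 7F ∷ 8F ∷ []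
petersenNeighbours 6F = 1F ∷ 9F ∷ 8F ∷ []
petersenNeighbours 7F = 2F ∷ 5F ∷ 9F ∷ []
petersenNeighbours 8F = 3F ∷ 6F ∷ 5F ∷ []
petersenNeighbours 9F = 4F ∷ 7F ∷ 6F ∷ []

petersenNeighbours-complete : ∀ {x y} → Petersen x y ≡ true → y ∈ petersenNeighbours x
petersenNeighbours-complete {x} {y} = toWitness {a? = all? λ x → all? λ y →
  (Petersen x y Bool.≟ true) →-dec (y ∈? petersenNeighbours x)} _ x y
  where open import Data.List.Membership.DecPropositional (_≟_ {10}) using (_∈?_)

petersen-cubic : IsCubic Petersen
petersen-cubic = toWitness {a? = all? λ x → deg Petersen x ℕ.≟ 3} _

petersen-noDomatic3Colouring : (c : Fin 10 → Fin 3) → ¬ IsDomaticColouring Petersen c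
petersen-noDomatic3Colouring c = refutes-sound (allFin 10) [] _
  where open ColouringSearch Petersen petersenNeighbours petersenNeighbours-complete

-- Exploring a regular graph

witness : ∀ {P : Set} (d : Dec P) → ⌊ d ⌋ ≡ true → P
witness (yes p) _ = p

data Adjacency : Set where
  adjacent nonadjacent unknown : Adjacency

infix 4 _≟ₐ_ _Describes_

_≟ₐ_ : (x y : Adjacency) → Dec (x ≡ y)
adjacent ≟ₐ adjacent = yes refl
nonadjacent ≟ₐ nonadjacent = yes refl
unknown ≟ₐ unknown = yes refl
adjacent ≟ₐ nonadjacent = no λ ()
adjacent ≟ₐ unknown = no λ ()
nonadjacent ≟ₐ adjacent = no λ ()
nonadjacent ≟ₐ unknown = no λ ()
unknown ≟ₐ adjacent = no λ ()
unknown ≟ₐ nonadjacent = no λ ()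

fromBool : Bool → Adjacency
fromBool true = adjacent
fromBool false = nonadjacent

close : Adjacency → Adjacency
close adjacent = adjacent
close _ = nonadjacent

data _Describes_ : Adjacency → Bool → Set where
  adjacent : adjacent Describes true
  nonadjacent : nonadjacent Describes false
  unknown : ∀ {b} → unknown Describes b

adjacent-describes : ∀ {x b} → x ≡ adjacent → x Describes b → b ≡ true
adjacent-describes refl adjacent = refl

fromBool-describes : ∀ {b b′} → fromBool b Describes b′ → b ≡ b′
fromBool-describes {true} adjacent = refl
fromBool-describes {false} nonadjacent = refl

describes-true⇒≢nonadjacent : ∀ {x} → x Describes true → x ≢ nonadjacent
describes-true⇒≢nonadjacent adjacent ()
describes-true⇒≢nonadjacent unknown ()

describes-true⇒≢unknown⇒adjacent : ∀ {x} → x Describes true → x ≢ unknown → x ≡ adjacent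
describes-true⇒≢unknown⇒adjacent adjacent _ = refl
describes-true⇒≢unknown⇒adjacent unknown x≢unknown = ⊥-elim (x≢unknown refl)

close-describes : ∀ {x b} → x Describes b → (b ≡ true → x ≡ adjacent) → close x Describes b
close-describes adjacent _ = adjacent
close-describes nonadjacent _ = nonadjacent
close-describes {b = false} unknown _ = nonadjacent
close-describes {b = true} unknown unknown≡adjacent with () ← unknown≡adjacent refl

-- Indexed by labels, newest first: the most recently labelled vertex has label zero.
Knowledge : ℕ → Set
Knowledge k = Vec (Vec Adjacency k) k

infix 10 _⟨_,_⟩
_⟨_,_⟩ : ∀ {k} → Knowledge k → Fin k → Fin k → Adjacency
K ⟨ a , b ⟩ = lookup (lookup K a) b

tabulate-⟨⟩ : ∀ {k} (f : Fin k → Fin k → Adjacency) a b → tabulate (tabulate ∘ f) ⟨ a , b ⟩ ≡ f a b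
tabulate-⟨⟩ f a b =
  trans (cong (λ row → lookup row b) (lookup∘tabulate (tabulate ∘ f) a)) (lookup∘tabulate (f a) b)

module _ {k : ℕ} where

  adjacent? : (K : Knowledge k) (a b : Fin k) → Dec (K ⟨ a , b ⟩ ≡ adjacent)
  adjacent? K a b = K ⟨ a , b ⟩ ≟ₐ adjacent

  possible? : (K : Knowledge k) (a b : Fin k) → Dec (K ⟨ a , b ⟩ ≢ nonadjacent)
  possible? K a b = ¬? (K ⟨ a , b ⟩ ≟ₐ nonadjacent)

  adjacentLabels possibleLabels : Knowledge k → Fin k → List (Fin k)
  adjacentLabels K a = filter (adjacent? K a) (allFin k)
  possibleLabels K a = filter (possible? K a) (allFin k)

  adjacencyGraph : Knowledge k → Graph k
  adjacencyGraph K a b = ⌊ adjacent? K a b ⌋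

  set : Fin k → Fin k → Adjacency → Knowledge k → Knowledge k
  set a b x K = K [ a ]%= (_[ b ]≔ x)

  learn : Fin k → Fin k → Adjacency → Knowledge k → Knowledge k
  learn a b x = set b a x ∘ set a b x

  -- Column a is read off row a, so no symmetry of the knowledge matrix is needed.
  sealEntry : Fin k → Knowledge k → Fin k → Fin k → Adjacency
  sealEntry a K c d = if ⌊ c ≟ a ⌋ then close (K ⟨ a , d ⟩)
                 else if ⌊ d ≟ a ⌋ then close (K ⟨ a , c ⟩)
                 else K ⟨ c , d ⟩

  seal : Fin k → Knowledge k → Knowledge k
  seal a K = tabulate λ c → tabulate (sealEntry a K c)

extend : ∀ {k} → Vec Adjacency k → Knowledge k → Knowledge (suc k)
extend row K = (nonadjacent ∷ row) ∷ zipWith _∷_ row K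

module Exploration (n r m : ℕ) (H : Graph n) where

  -- A vertex with r known neighbours has no others.
  closeAt : ∀ {k} → Fin k → Knowledge k → Knowledge k
  closeAt a K = if ⌊ length (adjacentLabels K a) ℕ.≟ r ⌋ then seal a K else K

  newEntry : ∀ {k} → Knowledge k → Fin k → Adjacency
  newEntry K b = if ⌊ length (adjacentLabels K b) ℕ.≟ r ⌋ then nonadjacent else unknown

  newRow : ∀ {k} → Knowledge k → Vec Adjacency k
  newRow K = tabulate (newEntry K)

  data Certificate : ℕ → Set where
    split : ∀ {k} → Fin k → Fin k → Certificate k → Certificate k → Certificate k
    addNeighbour : ∀ {k} → Fin k → Certificate (suc k) → Certificate k
    addVertex : ∀ {k} → Certificate (suc k) → Certificate k
    degreeViolated : ∀ {k} → Fin k → Certificate k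
    domatic : Vec (Fin m) n → Certificate n
    isomorphic : Vec (Fin n) n → Vec (Fin n) n → Certificate n

  neighbourAddable? : ∀ {k} (K : Knowledge k) a →
    Dec ((∀ b → K ⟨ a , b ⟩ ≢ unknown) × length (adjacentLabels K a) < r)
  neighbourAddable? K a =
    all? (λ b → ¬? (K ⟨ a , b ⟩ ≟ₐ unknown)) ×-dec (length (adjacentLabels K a) <? r)

  degreeViolated? : ∀ {k} (K : Knowledge k) a →
    Dec (r < length (adjacentLabels K a) ⊎ length (possibleLabels K a) + (n ∸ k) < r)
  degreeViolated? {k} K a =
    (r <? length (adjacentLabels K a)) ⊎-dec (length (possibleLabels K a) + (n ∸ k) <? r)

  isomorphic? : (K : Knowledge n) (p q : Vec (Fin n) n) →
    Dec ((∀ a b → K ⟨ a , b ⟩ ≡ fromBool (H (lookup p a) (lookup p b))) ×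
         (∀ v → lookup p (lookup q v) ≡ v) × (∀ a → lookup q (lookup p a) ≡ a))
  isomorphic? K p q = all? (λ a → all? λ b → K ⟨ a , b ⟩ ≟ₐ fromBool (H (lookup p a) (lookup p b)))
    ×-dec all? (λ v → lookup p (lookup q v) ≟ v) ×-dec all? (λ a → lookup q (lookup p a) ≟ a)

  check : ∀ {k} → Certificate k → Knowledge k → Bool
  check (split a b s t) K =
    check s (closeAt a (closeAt b (learn a b adjacent K))) ∧ check t (learn a b nonadjacent K)
  check (addNeighbour a s) K =
    ⌊ neighbourAddable? K a ⌋ ∧ check s (closeAt (suc a) (extend (newRow K [ a ]≔ adjacent) K))
  check {k} (addVertex s) K = ⌊ k <? n ⌋ ∧ check s (extend (newRow K) K)
  check (degreeViolated a) K = ⌊ degreeViolated? K a ⌋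
  check (domatic c) K = ⌊ isDomaticColouring? (adjacencyGraph K) (lookup c) ⌋
  check (isomorphic p q) K = ⌊ isomorphic? K p q ⌋

  readFin : ∀ {j} → List ℕ → Maybe (Fin j × List ℕ)
  readFin [] = nothing
  readFin {j} (d ∷ ds) with d <? j
  ... | yes d<j = just (fromℕ< d<j , ds)
  ... | no _ = nothing

  readVec : ∀ {A : Set} len → (List ℕ → Maybe (A × List ℕ)) → List ℕ → Maybe (Vec A len × List ℕ)
  readVec zero read ds = just ([] , ds)
  readVec (suc len) read ds = do
    (x , ds) ← read ds
    (xs , ds) ← readVec len read ds
    just (x ∷ xs , ds)

  parse : ℕ → (k : ℕ) → List ℕ → Maybe (Certificate k × List ℕ)
  parse zero k ds = nothing
  parse (suc fuel) k (0 ∷ ds) = do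
    (a , ds) ← readFin ds
    (b , ds) ← readFin ds
    (s , ds) ← parse fuel k ds
    (t , ds) ← parse fuel k ds
    just (split a b s t , ds)
  parse (suc fuel) k (1 ∷ ds) = do
    (a , ds) ← readFin ds
    (s , ds) ← parse fuel (suc k) ds
    just (addNeighbour a s , ds)
  parse (suc fuel) k (2 ∷ ds) = do
    (s , ds) ← parse fuel (suc k) ds
    just (addVertex s , ds)
  parse (suc fuel) k (3 ∷ ds) = do
    (a , ds) ← readFin ds
    just (degreeViolated a , ds)
  parse (suc fuel) k (4 ∷ ds) with k ℕ.≟ n
  ... | yes refl = do
    (c , ds) ← readVec n readFin ds
    just (domatic c , ds)
  ... | no _ = nothing
  parse (suc fuel) k (5 ∷ ds) with k ℕ.≟ n
  ... | yes refl = do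
    (p , ds) ← readVec n readFin ds
    (q , ds) ← readVec n readFin ds
    just (isomorphic p q , ds)
  ... | no _ = nothing
  parse (suc fuel) k _ = nothing

  module Soundness (G : Graph n) (simple : IsSimple G) (regular : ∀ x → deg G x ≡ r) where
    open import Data.List.Membership.DecPropositional (_≟_ {n}) using (_∈?_)

    symmetric : ∀ x y → G x y ≡ G y x
    symmetric = proj₁ simple

    irreflexive : ∀ x → G x x ≡ false
    irreflexive = proj₂ simple

    degree : ∀ x → length (neighbours G x) ≡ r
    degree x = trans (length-neighbours G x) (regular x)

    record Labelling {k} (K : Knowledge k) : Set where
      field
        vertex : Fin k → Fin n
        injective : Injective _≡_ _≡_ vertex
        describes : ∀ a b → K ⟨ a , b ⟩ Describes G (vertex a) (vertex b)

    module _ {k} {K : Knowledge k} (L : Labelling K) where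
      open Labelling L

      Labelled : Fin n → Set
      Labelled y = ∃ λ a → vertex a ≡ y

      labelled? : ∀ y → Dec (Labelled y)
      labelled? y = any? λ a → vertex a ≟ y

      unlabelled : List (Fin n)
      unlabelled = filter (¬? ∘ labelled?) (allFin n)

      image-unique : ∀ {P : Fin k → Set} (P? : ∀ a → Dec (P a)) → Unique (map vertex (filter P? (allFin k)))
      image-unique P? = Unique.map⁺ injective (Unique.filter⁺ P? (Unique.allFin⁺ k))

      describes-adjacent : ∀ {a b} → G (vertex a) (vertex b) ≡ true → K ⟨ a , b ⟩ Describes true
      describes-adjacent {a} {b} xy = subst (K ⟨ a , b ⟩ Describes_) xy (describes a b)

      adjacentLabels-neighbours : ∀ a → map vertex (adjacentLabels K a) ⊆ neighbours G (vertex a)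
      adjacentLabels-neighbours a y∈ with ∈-map⁻ vertex y∈
      ... | b , b∈ , refl =
        ∈-neighbours⁺ G (adjacent-describes (∈-filter-allFin⁻ (adjacent? K a) b∈) (describes a b))

      adjacentLabels-≤ : ∀ a → length (adjacentLabels K a) ≤ r
      adjacentLabels-≤ a = subst₂ _≤_ (length-map vertex (adjacentLabels K a)) (degree (vertex a))
        (unique⇒length-≤ (image-unique (adjacent? K a)) (adjacentLabels-neighbours a))

      IsFull : Fin k → Set
      IsFull a = length (adjacentLabels K a) ≡ r

      full-neighbour : ∀ {a y} → IsFull a → G (vertex a) y ≡ true → y ∈ map vertex (adjacentLabels K a)
      full-neighbour {a} {y} full xy with y ∈? map vertex (adjacentLabels K a)
      ... | yes y∈ = y∈
      ... | no y∉ = ⊥-elim (n≮n r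
              (subst₂ _<_ (trans (length-map vertex (adjacentLabels K a)) full) (degree (vertex a))
                (unique⇒length-≤ (¬Any⇒All¬ _ y∉ ∷ image-unique (adjacent? K a)) y∷⊆N)))
        where
        y∷⊆N : y ∷ map vertex (adjacentLabels K a) ⊆ neighbours G (vertex a)
        y∷⊆N (here refl) = ∈-neighbours⁺ G xy
        y∷⊆N (there z∈) = adjacentLabels-neighbours a z∈

      full⇒adjacent : ∀ {a b} → IsFull a → G (vertex a) (vertex b) ≡ true → K ⟨ a , b ⟩ ≡ adjacent
      full⇒adjacent {a} full xy with ∈-map⁻ vertex (full-neighbour full xy)
      ... | b , b∈ , vb≡vb′ with injective vb≡vb′
      ... | refl = ∈-filter-allFin⁻ (adjacent? K a) b∈

      full⇒unlabelled-nonadjacent : ∀ {a y} → IsFull a → ¬ Labelled y → G (vertex a) y ≡ false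
      full⇒unlabelled-nonadjacent {a} {y} full unlabelled-y with G (vertex a) y in xy
      ... | false = refl
      ... | true with ∈-map⁻ vertex (full-neighbour full xy)
      ...   | b , _ , y≡vb = ⊥-elim (unlabelled-y (b , sym y≡vb))

      unlabelled-length : length unlabelled + k ≤ n
      unlabelled-length = subst₂ _≤_ lengths (length-tabulate _)
        (unique⇒length-≤ (Unique.++⁺ (Unique.filter⁺ (¬? ∘ labelled?) (Unique.allFin⁺ n))
                                      (Unique.map⁺ injective (Unique.allFin⁺ k)) disjoint)
          (λ {y} _ → ∈-allFin y))
        where
        lengths : length (unlabelled ++ map vertex (allFin k)) ≡ length unlabelled + k
        lengths = trans (length-++ unlabelled)
          (cong (length unlabelled +_) (trans (length-map vertex (allFin k)) (length-tabulate _)))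
        disjoint : Disjoint unlabelled (map vertex (allFin k))
        disjoint (y∈unlabelled , y∈image) with ∈-map⁻ vertex y∈image
        ... | a , _ , y≡va = ∈-filter-allFin⁻ (¬? ∘ labelled?) y∈unlabelled (a , sym y≡va)

      neighbours-possible : ∀ a → neighbours G (vertex a) ⊆ map vertex (possibleLabels K a) ++ unlabelled
      neighbours-possible a {y} y∈N with labelled? y
      ... | yes (b , refl) = ∈-++⁺ˡ (∈-map⁺ vertex (∈-filter-allFin⁺ (possible? K a)
              (describes-true⇒≢nonadjacent (describes-adjacent (∈-neighbours⁻ G y∈N)))))
      ... | no unlabelled-y = ∈-++⁺ʳ _ (∈-filter-allFin⁺ (¬? ∘ labelled?) unlabelled-y)

      possibleLabels-enough : ∀ a → r ≤ length (possibleLabels K a) + (n ∸ k)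
      possibleLabels-enough a = begin
        r                                           ≡⟨ degree (vertex a) ⟨
        length (neighbours G (vertex a))            ≤⟨ unique⇒length-≤ (neighbours-unique G (vertex a))
                                                                        (neighbours-possible a) ⟩
        length (possible ++ unlabelled)             ≡⟨ length-++ possible ⟩
        length possible + length unlabelled         ≡⟨ cong (_+ length unlabelled) (length-map vertex (possibleLabels K a)) ⟩
        length (possibleLabels K a) + length unlabelled
          ≤⟨ +-monoʳ-≤ _ (m+n≤o⇒m≤o∸n (length unlabelled) unlabelled-length) ⟩
        length (possibleLabels K a) + (n ∸ k)       ∎
        where
        open ≤-Reasoning
        possible : List (Fin n)
        possible = map vertex (possibleLabels K a)

      unlabelled-neighbour : ∀ {a} → (∀ b → K ⟨ a , b ⟩ ≢ unknown) → length (adjacentLabels K a) < r →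
        ∃ λ y → G (vertex a) y ≡ true × ¬ Labelled y
      unlabelled-neighbour {a} known sparse with Any.any? (¬? ∘ labelled?) (neighbours G (vertex a))
      ... | yes found with find found
      ...   | y , y∈N , unlabelled-y = y , ∈-neighbours⁻ G y∈N , unlabelled-y
      unlabelled-neighbour {a} known sparse | no none = ⊥-elim (<⇒≱ sparse
        (subst₂ _≤_ (degree (vertex a)) (length-map vertex (adjacentLabels K a))
          (unique⇒length-≤ (neighbours-unique G (vertex a)) N⊆adjacent)))
        where
        N⊆adjacent : neighbours G (vertex a) ⊆ map vertex (adjacentLabels K a)
        N⊆adjacent {y} y∈N with decidable-stable (labelled? y) (All.lookup (¬Any⇒All¬ _ none) y∈N)
        ... | b , refl = ∈-map⁺ vertex (∈-filter-allFin⁺ (adjacent? K a)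
              (describes-true⇒≢unknown⇒adjacent (describes-adjacent (∈-neighbours⁻ G y∈N)) (known b)))

      unlabelled-exists : k < n → ∃ λ y → ¬ Labelled y
      unlabelled-exists k<n with any? (¬? ∘ labelled?)
      ... | yes found = found
      ... | no none = ⊥-elim (<⇒≱ k<n
              (subst₂ _≤_ (length-tabulate _) (trans (length-map vertex (allFin k)) (length-tabulate _))
                (unique⇒length-≤ (Unique.allFin⁺ n) all-labelled)))
        where
        all-labelled : allFin n ⊆ map vertex (allFin k)
        all-labelled {y} _ with decidable-stable (labelled? y) (λ unlabelled-y → none (y , unlabelled-y))
        ... | a , refl = ∈-map⁺ vertex (∈-allFin a)

      extendLabelling : ∀ {y} {row : Vec Adjacency k} → ¬ Labelled y →
        (∀ b → lookup row b Describes G y (vertex b)) → Labelling (extend row K)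
      extendLabelling {y} {row} unlabelled-y row-describes = record
        { vertex = y ∷ᶠ vertex ; injective = injective′ ; describes = describes′ }
        where
        injective′ : Injective _≡_ _≡_ (y ∷ᶠ vertex)
        injective′ {zero} {zero} _ = refl
        injective′ {zero} {suc b} y≡vb = ⊥-elim (unlabelled-y (b , sym y≡vb))
        injective′ {suc a} {zero} va≡y = ⊥-elim (unlabelled-y (a , va≡y))
        injective′ {suc a} {suc b} va≡vb = cong suc (injective va≡vb)
        describes′ : ∀ a b → extend row K ⟨ a , b ⟩ Describes G ((y ∷ᶠ vertex) a) ((y ∷ᶠ vertex) b)
        describes′ zero zero = subst (nonadjacent Describes_) (sym (irreflexive y)) nonadjacent
        describes′ zero (suc b) = row-describes b
        describes′ (suc a) zero =
          subst (_Describes _) (sym (cong (λ row′ → lookup row′ zero) (lookup-zipWith _∷_ a row K)))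
            (subst (lookup row a Describes_) (symmetric y (vertex a)) (row-describes a))
        describes′ (suc a) (suc b) =
          subst (_Describes _) (sym (cong (λ row′ → lookup row′ (suc b)) (lookup-zipWith _∷_ a row K)))
            (describes a b)

      newRow-describes : ∀ {y} → ¬ Labelled y → ∀ b → lookup (newRow K) b Describes G y (vertex b)
      newRow-describes {y} unlabelled-y b =
        subst (_Describes _) (sym (lookup∘tabulate (newEntry K) b)) entry-describes
        where
        entry-describes : newEntry K b Describes G y (vertex b)
        entry-describes with length (adjacentLabels K b) ℕ.≟ r
        ... | yes full = subst (nonadjacent Describes_)
                (sym (trans (symmetric y (vertex b)) (full⇒unlabelled-nonadjacent full unlabelled-y))) nonadjacent
        ... | no _ = unknown

      neighbourRow-describes : ∀ {a y} → G (vertex a) y ≡ true → ¬ Labelled y →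
        ∀ b → lookup (newRow K [ a ]≔ adjacent) b Describes G y (vertex b)
      neighbourRow-describes {a} {y} xy unlabelled-y b with b ≟ a
      ... | yes refl = subst (_Describes _) (sym (lookup∘update b (newRow K) adjacent))
              (subst (adjacent Describes_) (sym (trans (symmetric y (vertex b)) xy)) adjacent)
      ... | no b≢a = subst (_Describes _) (sym (lookup∘update′ b≢a (newRow K) adjacent))
              (newRow-describes unlabelled-y b)

      setLabelling : ∀ {a b x} → x Describes G (vertex a) (vertex b) → Labelling (set a b x K)
      setLabelling {a} {b} {x} x-describes =
        record { vertex = vertex ; injective = injective ; describes = describes′ }
        where
        describes′ : ∀ c d → set a b x K ⟨ c , d ⟩ Describes G (vertex c) (vertex d)
        describes′ c d with c ≟ a
        ... | no c≢a =
          subst (_Describes _) (sym (cong (λ row → lookup row d) (lookup∘updateAt′ c a c≢a K))) (describes c d)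
        ... | yes refl with d ≟ b
        ...   | yes refl = subst (_Describes _)
                  (sym (trans (cong (λ row → lookup row d) (lookup∘updateAt c K)) (lookup∘update d (lookup K c) x)))
                  x-describes
        ...   | no d≢b = subst (_Describes _)
                  (sym (trans (cong (λ row → lookup row d) (lookup∘updateAt c K)) (lookup∘update′ d≢b (lookup K c) x)))
                  (describes c d)

      sealLabelling : ∀ {a} → IsFull a → Labelling (seal a K)
      sealLabelling {a} full = record { vertex = vertex ; injective = injective ; describes = describes′ }
        where
        closed : ∀ d → close (K ⟨ a , d ⟩) Describes G (vertex a) (vertex d)
        closed d = close-describes (describes a d) (full⇒adjacent full)
        entry-describes : ∀ c d → sealEntry a K c d Describes G (vertex c) (vertex d)
        entry-describes c d with c ≟ a | d ≟ a
        ... | yes refl | _ = closed d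
        ... | no _ | yes refl =
          subst (close (K ⟨ a , c ⟩) Describes_) (symmetric (vertex a) (vertex c)) (closed c)
        ... | no _ | no _ = describes c d
        describes′ : ∀ c d → seal a K ⟨ c , d ⟩ Describes G (vertex c) (vertex d)
        describes′ c d = subst (_Describes _) (sym (tabulate-⟨⟩ (sealEntry a K) c d)) (entry-describes c d)

    learnLabelling : ∀ {k} {K : Knowledge k} (L : Labelling K) {a b x} →
      x Describes G (Labelling.vertex L a) (Labelling.vertex L b) → Labelling (learn a b x K)
    learnLabelling L {a} {b} x-describes = setLabelling (setLabelling L x-describes)
      (subst (_ Describes_) (symmetric (Labelling.vertex L a) (Labelling.vertex L b)) x-describes)

    closeAtLabelling : ∀ {k} {K : Knowledge k} → Labelling K → ∀ a → Labelling (closeAt a K)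
    closeAtLabelling {K = K} L a with length (adjacentLabels K a) ℕ.≟ r
    ... | yes full = sealLabelling L full
    ... | no _ = L

    module _ {K : Knowledge n} (L : Labelling K) where
      open Labelling L

      vertex-surjective : ∀ y → Labelled L y
      vertex-surjective y = decidable-stable (labelled? L y) λ unlabelled-y → 1+n≰n (injective⇒≤
        (Labelling.injective (extendLabelling L {row = newRow K} unlabelled-y (newRow-describes L unlabelled-y))))

      vertex-↔ : Fin n ↔ Fin n
      vertex-↔ = mk↔ₛ′ vertex (proj₁ ∘ vertex-surjective) (proj₂ ∘ vertex-surjective)
        (λ a → injective (proj₂ (vertex-surjective (vertex a))))

    Outcome : Set
    Outcome = Σ (Fin n → Fin m) (IsDomaticColouring G) ⊎ G ≅ H

    sound : ∀ {k} (s : Certificate k) {K : Knowledge k} → check s K ≡ true → Labelling K → Outcome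
    sound (split a b s t) ok L with G (Labelling.vertex L a) (Labelling.vertex L b) in e
    ... | true = sound s (∧-conicalˡ _ _ ok)
            (closeAtLabelling (closeAtLabelling
              (learnLabelling L (subst (adjacent Describes_) (sym e) adjacent)) b) a)
    ... | false = sound t (∧-conicalʳ _ _ ok)
            (learnLabelling L (subst (nonadjacent Describes_) (sym e) nonadjacent))
    sound (addNeighbour a s) {K} ok L with witness (neighbourAddable? K a) (∧-conicalˡ _ _ ok)
    ... | known , sparse with unlabelled-neighbour L known sparse
    ...   | y , xy , unlabelled-y = sound s (∧-conicalʳ _ _ ok)
            (closeAtLabelling (extendLabelling L unlabelled-y (neighbourRow-describes L xy unlabelled-y)) (suc a))
    sound {k} (addVertex s) ok L with unlabelled-exists L (witness (k <? n) (∧-conicalˡ _ _ ok))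
    ... | y , unlabelled-y =
      sound s (∧-conicalʳ _ _ ok) (extendLabelling L unlabelled-y (newRow-describes L unlabelled-y))
    sound (degreeViolated a) {K} ok L with witness (degreeViolated? K a) ok
    ... | inj₁ overfull = ⊥-elim (<⇒≱ overfull (adjacentLabels-≤ L a))
    ... | inj₂ starved = ⊥-elim (<⇒≱ starved (possibleLabels-enough L a))
    sound (domatic c) {K} ok L = inj₁ (lookup c ∘ Inverse.from (vertex-↔ L) ,
      domaticColouring-transport (vertex-↔ L)
        (λ a b ab → adjacent-describes (witness (adjacent? K a b) ab) (Labelling.describes L a b))
        (witness (isDomaticColouring? (adjacencyGraph K) (lookup c)) ok))
    sound (isomorphic p q) {K} ok L with witness (isomorphic? K p q) ok
    ... | edges , p∘q≡id , q∘p≡id =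
      inj₂ (≅-trans {H = relabelled} {I = H} (≅-sym (vertex-↔ L , relabelling))
                    (mk↔ₛ′ (lookup p) (lookup q) p∘q≡id q∘p≡id , λ _ _ → refl))
      where
      relabelled : Graph n
      relabelled a b = H (lookup p a) (lookup p b)
      relabelling : ∀ a b → relabelled a b ≡ G (Labelling.vertex L a) (Labelling.vertex L b)
      relabelling a b = fromBool-describes (subst (_Describes _) (edges a b) (Labelling.describes L a b))

-- Cubic graphs on ten vertices

digits : List String → List ℕ
digits = concatMap (map (λ c → Char.toℕ c ∸ Char.toℕ (toDigitChar 0)) ∘ toList)

open Exploration 10 3 3 Petersen

-- Found by a computer search.
cubic10Certificate : List ℕ
cubic10Certificate = digits (
  "210110101202001021011010120200102301101010303001012010103030120200101130" ∷
  "310101202001042102102100313231120200101202010303012020010123012020010421" ∷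
  "201021003132320101202001013301302001042121002100313201013030010421210021" ∷
  "003133301202001013030020421210021003233313211010101011010110101030301101" ∷
  "012020010421001220103132311101011010101030110101101010303011010120200104" ∷
  "210012210031323111010120200102301101010303001012010103030120200101130310" ∷
  "101202001042100122100313231120200101202010303012020010123012020010421001" ∷
  "221003132320101202001013301302001042010122100313201013030010420101221003" ∷
  "133301202001013030020410201221003233313201012010101011010110101030301101" ∷
  "012020010421001221003132311101011010101030110101101010303011010120200104" ∷
  "201102210031323111010120200102301101010303001012010103030120200101130310" ∷
  "101202001042101022100313231120200101202010303012020010123012020010421100" ∷
  "221003132320101202001013301302001042110022100313201013030010421100221003" ∷
  "133301202001013030020410210221003233313212020010111011010110101030301101" ∷
  "012020010421001221003132311101012010101030110101101010303011010120200104" ∷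
  "201102210031323112020010111030110101201010303012020010113031010120200104" ∷
  "021102210031323101012020010230110101030300101201010303012020010113031010" ∷
  "120200104210102210031323112020010120201030301202001012301202001042011022" ∷
  "100313232010120200101330130200104210102210031320101303001042101022100313" ∷
  "330120200101303002041021022100323331320101202001021011010120200104210021" ∷
  "021031323111010101030110101101010303011010120200104001221021031323101012" ∷
  "010101030110101101010303011010120200104100221021031323112020010111030110" ∷
  "101201010303012020010113031010120200104210201021031323101012020010230110" ∷
  "101030300101201010303012020010113031010120200104102211021031323112020010" ∷
  "120201030301202001012301202001040122010210313232010120200101330130200104" ∷
  "001122210031320101303001040011222100313330120200101303002040011222100323" ∷
  "331321202001012020101030120101101010303011010120200104102210021031323112" ∷
  "020010121030120200102301101010303001012010103030120200101130310101202001" ∷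
  "041202100210313231010120101301010303013020010113031010120200104120210021" ∷
  "031323112020010130201030301302001012301202001041022100210313232010130300" ∷
  "201130010123012020010412021002103132020010133013020010401012221003132010" ∷
  "130300104010122210031333013030020313202001013030020401012221003233313201" ∷
  "012020010131030130200102301101010303001012010103030120200101130310101202" ∷
  "001042012010210313231010130300102301101010303001013010103030130200101130" ∷
  "310101202001040212100210313231130300201130010120201030301202001012301202" ∷
  "001042021010210313232020010130201030301302001012301202001040221100210313" ∷
  "232010130300201130010123012020010402211002103132020010133013020010401102" ∷
  "221003132010130300104011022210031333013030020313202001013030020401102221" ∷
  "003233313212020010130300202301201010303002013010103030130300101130310101" ∷
  "302001040212100210313231130300201202010303001012301202001013301302001040" ∷
  "110222100313201013030010410102221003133300200101303010303013030020113001" ∷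
  "012301202001041012200210313202001013301302001040110222100313201013030010" ∷
  "401012221003133300101303001013301302001040110222100313233130300203101013" ∷
  "030020401012221003233313301013030020130201030300101303010303013030020113" ∷
  "001012301202001041021200210313202001013301302001040110222100313201013030" ∷
  "010410102221003133300200101330130200101430140200104011022210031320101403" ∷
  "001041010222100313330010130300101430140200104101022210031320101404001041" ∷
  "010222100313430130300203101014030020410102221003233310200101404002040110" ∷
  "222100323431010140400303233343113030020130300201230320201303001040221100" ∷
  "210313332010130300201330130300104101022210031333313030020130300204011022" ∷
  "210032333233020010130300201430140300104101022210031330201404001040110222" ∷
  "100313430130300201403002041001222100323332020010140400304010122210033341" ∷
  "404003032333432010130300201404002040110222100323401014040030410102221003" ∷
  "334140400303233343313030020313233120200101202010101101011010103030110101" ∷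
  "202001042100212100313231120101101010103011010110101030301101012020010410" ∷
  "220121003132311101012020010230110101030300101201010303012020010113031010" ∷
  "120200104210201210031323112020010120201030301202001012301202001042120012" ∷
  "100313232010120200101330130200104212001210031320101303001042120012100313" ∷
  "330120200101303002042021012100323331321202001012101101011010103030110101" ∷
  "202001042100212100313231120200102101101012020010421002120103132311101010" ∷
  "103011010110101030301101012020010400122120103132310101201010103011010110" ∷
  "101030301101012020010421002120103132311202001011103011010120101030301202" ∷
  "001011303101012020010401022120103132310101202001023011010103030010120101" ∷
  "030301202001011303101012020010401212120103132311202001012020103030120200" ∷
  "101230120200104002121210031323201012020010133013020010401202120103132010" ∷
  "130300104102021201031333012020010130300204002121210032333132010120101301" ∷
  "010103011010110101030301101012020010410220121003132311302001011103011010" ∷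
  "120101030301202001011303101012020010402120121003132310101202001023011010" ∷
  "103030010120101030301202001011303101012020010421020121003132311202001012" ∷
  "020103030120200101230120200104102201210031323201012020010133013020010421" ∷
  "020121003132010130300104210201210031333012020010130300204201201210032333" ∷
  "132120200101302010103012010110101030301101012020010410221020103132311302" ∷
  "001012103012020010230110101030300101201010303012020010113031010120200104" ∷
  "120210201031323101012010130101030301302001011303101012020010412021020103" ∷
  "132311202001013020103030130200101230120200104102210201031323201013030020" ∷
  "113001012301202001041202102010313202001013301302001040202112100313201013" ∷
  "030010402021121003133301303002031320200101303002040202112100323331320101" ∷
  "303002011103001012103012020010230110101030300101201010303012020010113031" ∷
  "010120200104210120201031323102001013103013020010230110101030300101201010" ∷
  "303012020010113031010120200104021201210031323101013030010230110101030300" ∷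
  "101301010303013020010113031010120200104021201210031323113030020113001012" ∷
  "020103030120200101230120200104200121201031323202001013020103030130200101" ∷
  "230120200104021120201031323201013030020113001012301202001040212012100313" ∷
  "202001013301302001040210212100313201013030010410212020103133301303002031" ∷
  "320200101303002040210212100323331321303002012020120101030301201013020010" ∷
  "410212020103132310101202013010103030130300101130310101302001041202102010" ∷
  "313231120200101303010303013030020113001012301202001040201212100313202001" ∷
  "013301302001040122102010313201013030010402012121003133300101303001013301" ∷
  "302001040212102010313233130300203101013030020402012121003233313302001013" ∷
  "030020230120101030300201301010303013030010113031010130200104201201210031" ∷
  "323113030020120201030300101230120200101330130200104200211201031320101303" ∷
  "001042002112010313330020010130301030301303002011300101230120200104021201" ∷
  "210031320200101330130200104201201210031320101303001041022102010313330010" ∷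
  "130300101330130200104021210201031323313030020310101303002040212012100323" ∷
  "331330101303002013020103030010130301030301303002011300101230120200104021" ∷
  "201210031320200101330130200104021201210031320101303001040212102010313330" ∷
  "020010133013020010143014020010420120121003132010140300104201201210031333" ∷
  "001013030010143014020010402120121003132010140400104201201210031343013030" ∷
  "020310101403002040212012100323331020010140400204201201210032343101014040" ∷
  "030323334311303002013030020123032020130300104102210201031333201013030020" ∷
  "133013030010402121020103133331303002013030020402120121003233323302001013" ∷
  "030020143014030010402120121003133020140400104201201210031343013030020140" ∷
  "300204021201210032333202001014040030420120121003334140400303233343201013" ∷
  "030020140400204021021210032340101404003042010212100333414040030323334331" ∷
  "303002031323301012020010131011010110101030301101012020010420112121003132" ∷
  "311302001021011010120200104210021210031323111010101030110101101010303011" ∷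
  "010120200104001221210031323101012010101030110101101010303011010120200104" ∷
  "210021210031323112020010111030110101201010303012020010113031010120200104" ∷
  "010221210031323101012020010230110101030300101201010303012020010113031010" ∷
  "120200104012121210031323112020010120201030301202001012301202001040120212" ∷
  "100313232010120200101330130200104012021210031320101303001041020212100313" ∷
  "330120200101303002040021212010323331320101303001021011010120200104210021" ∷
  "210031323111010101030110101101010303011010120200104210021210031323101013" ∷
  "010101030110101101010303011010120200104210021210031323113020010111030110" ∷
  "101201010303012020010113031010120200104210021210031323101012020010230110" ∷
  "101030300101201010303012020010113031010120200104210021210031323112020010" ∷
  "120201030301202001012301202001042100212100313232010120200101330130200104" ∷
  "102021210031320101303001041020212100313330120200101303002042001212010323" ∷
  "331321303002011120101101010303011010120200104202121210031323101012020101" ∷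
  "030120101101010303011010120200104210021210031323112020010121030120200102" ∷
  "301101010303001012010103030120200101130310101202001041020212100313231010" ∷
  "120101301010303013020010113031010120200104120021210031323112020010130201" ∷
  "030301302001012301202001041200212100313232010130300201130010123012020010" ∷
  "410202121003132020010133013020010420011220103132010130300104120021210031" ∷
  "333013030020313202001013030020412002121003233313202001013020101030120101" ∷
  "101010303011010120200104210021210031323113020010121030120200102301101010" ∷
  "303001012010103030120200101130310101202001040122212100313231010120101301" ∷
  "010303013020010113031010120200104020121210031323112020010130201030301302" ∷
  "001012301202001040210212100313232010130300201130010123012020010401202121" ∷
  "003132020010133013020010402011220103132010130300104102021210031333013030" ∷
  "020313202001013030020412002121003233313201013030020111030010121030120200" ∷
  "102301101010303001012010103030120200101130310101202001042100212100313231" ∷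
  "020010131030130200102301101010303001012010103030120200101130310101202001" ∷
  "042100212100313231010130300102301101010303001013010103030130200101130310" ∷
  "101202001042100212100313231130300201130010120201030301202001012301202001" ∷
  "042100212100313232020010130201030301302001012301202001041200212100313232" ∷
  "010130300201130010123012020010420102121003132020010133013020010412002121" ∷
  "003132010130300104210021210031333013030020313202001013030020412002121003" ∷
  "233313213030020120201201010303012010130200104102021210031323101012020130" ∷
  "101030301303001011303101013020010412002121003132311202001013030103030130" ∷
  "300201130010123012020010402102121003132020010133013020010412002121003132" ∷
  "010130300104120021210031333001013030010133013020010410202121003132331303" ∷
  "002031010130300204120021210032333133020010130300202301201010303002013010" ∷
  "103030130300101130310101302001041200212100313231130300201202010303001012" ∷
  "301202001013301302001041002212100313201013030010401022121003133300200101" ∷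
  "303010303013030020113001012301202001040012212100313202001013301302001041" ∷
  "200212100313201013030010421001221003133300101303001013301302001041002212" ∷
  "100313233130300203101013030020421001221003233313301013030020130201030300" ∷
  "101303010303013030020113001012301202001040120212100313202001013301302001" ∷
  "041200212100313201013030010412002121003133300200101330130200101430140200" ∷
  "104021021210031320101403001042010212100313330010130300101430140200104200" ∷
  "121210031320101404001042001212100313430130300203101014030020421002121003" ∷
  "233310200101404002041200212100323431010140400303233343113030020130300201" ∷
  "230320201303001041200212100313332010130300201330130300104102021210031333" ∷
  "313030020130300204120021210032333233020010130300201430140300104201021210" ∷
  "031330201404001040210212100313430130300201403002041200122100323332020010" ∷
  "140400304210012210033341404003032333432010130300201404002041200212100323" ∷
  "401014040030421002121003334140400303233343313030020313233120200101303002" ∷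
  "021011010120200104210021210031323112010101030110101101010303011010120200" ∷
  "104210021210031323102013010101030110101101010303011010120200104001221210" ∷
  "031323113030010111030110101201010303012020010113031010120200104010221210" ∷
  "031323101013020010230110101030300101201010303012020010113031010120200104" ∷
  "010221210031323113020010120201030301202001012301202001040112212100313232" ∷
  "010120200101330130200104100221210031320101303001040102212100313330120200" ∷
  "101303002040012202110323331321303002012020101030120101101010303011010120" ∷
  "200104002121210031323101012130101101010303011010120200104201121210031323" ∷
  "112020010131030130200102301101010303001012010103030120200101130310101202" ∷
  "001040012212100313231010130300102301101010303001013010103030130200101130" ∷
  "310101202001040211212100313231130300201130010120201030301202001012301202" ∷
  "001040021212100313232020010130201030301302001012301202001040211212100313" ∷
  "232010130300201130010123012020010402102121003132020010133013020010402102" ∷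
  "121003132010130300104020121210031333013030020313202001013030020402112021" ∷
  "103233313202001013030101030130101101010303011010120200104001221210031323" ∷
  "113030020111030010121030120200102301101010303001012010103030120200101130" ∷
  "310101202001042100122100313231020010131030130200102301101010303001012010" ∷
  "103030120200101130310101202001040112212100313231010130300102301101010303" ∷
  "001013010103030130200101130310101202001042100122100313231130300201130010" ∷
  "120201030301202001012301202001041200122100313232020010130201030301302001" ∷
  "012301202001040212212100313232010130300201130010123012020010420101221003" ∷
  "132020010133013020010412001221003132010130300104210012210031333013030020" ∷
  "313202001013030020421001221003233313201013030010131030130200102301101010" ∷
  "303001012010103030120200101130310101202001040012212100313231010130101401" ∷
  "010303014020010113031010120200104010221210031323113020010140201030301402" ∷
  "001012301202001040112212100313232010140300201130010123012020010401122121" ∷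
  "003132020010133013020010401122120103132010130300104010221210031333014030" ∷
  "020313202001013030020400122121003233313213030020130201201010303012010130" ∷
  "200104201012210031323101013030020230120101030300201301010303013030010113" ∷
  "031010130200104201012210031323113030020120201030300101230120200101330130" ∷
  "200104021012210031320101303001042010122100313330020010130301030301303002" ∷
  "011300101230120200104021221210031320200101330130200104200112210031320101" ∷
  "303001042010122100313330010130300101330130200104201012210031323313030020" ∷
  "310101303002042010122100323331330200101302014010103030140300101130310101" ∷
  "302001042100122100313231130200101403010303014030020113001012301202001040" ∷
  "112212100313202001013301302001042100122100313201013030010421001221003133" ∷
  "300101403001013301302001042010122100313233140300203101013030020421001221" ∷
  "003233313301013030020140201030300101403010303014030020113001012301202001" ∷
  "040122212100313202001013301302001040122212010313201013030010421001221003" ∷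
  "133300200101404010303014040020113001012301202001040212212100313202001014" ∷
  "301402001040112022110313201014030010401021221003133300101404003011300101" ∷
  "330130200104021221201031320300101430140200104011202211031320101404001040" ∷
  "102122100313430140400303102031010130300204210012210032333103002031010140" ∷
  "300204001212210032333102001014040020400121221003234310101404003032333431" ∷
  "130300201403002012303202013030010421001221003133320101403002013301303001" ∷
  "042010122100313333140300201303002040021201210323332330200101404003012300" ∷
  "201330130300104020120121031330300201430140300104012012210031330201404001" ∷
  "040120122100313430140400303202013030020421001221003233320300201403002040" ∷
  "210122100323332020010140400304210012210033341404003032333432010140400301" ∷
  "303002042010122100323333030020140400204021012210032340101404003042100122" ∷
  "100333414040030323334331404003032330300203132330101303002013020101030120" ∷
  "101101010303011010120200104210021210031323101013030101030130101101010303" ∷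
  "011010120200104210021210031323113030020111030010121030120200102301101010" ∷
  "303001012010103030120200101130310101202001042100212100313231020010131030" ∷
  "130200102301101010303001012010103030120200101130310101202001042100212100" ∷
  "313231010130300102301101010303001013010103030130200101130310101202001042" ∷
  "100212100313231130300201130010120201030301202001012301202001042100212100" ∷
  "313232020010130201030301302001012301202001041200212100313232010130300201" ∷
  "130010123012020010420102121003132020010133013020010412002121003132010130" ∷
  "300104210021210031333013030020313202001013030020412002121003233313202001" ∷
  "013140101101010303011010120200104202121210031323113020010141030140200102" ∷
  "301101010303001012010103030120200101130310101202001040122212100313231010" ∷
  "140300102301101010303001013010103030130200101130310101202001040021212100" ∷
  "313231140300201130010120201030301202001012301202001040122212100313232020" ∷
  "010130201030301302001012301202001040012212100313232010130300201130010123" ∷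
  "012020010401202121003132020010133013020010410022121003132010130300104102" ∷
  "021210031333013030020313202001013030020402112012103233313201013030010141" ∷
  "030140200102301101010303001012010103030120200101130310101202001041020212" ∷
  "100313231010140400102301101010303001014010103030140200101130310101202001" ∷
  "041020212100313231140400201130010120201030301202001012301202001040221212" ∷
  "100313232020010140201030301402001012301202001040221212100313232010140300" ∷
  "201130010123012020010410202121003132020010133013020010410202121003132010" ∷
  "130300104102021210031333014030020313202001013030020402112102103233313213" ∷
  "030020140201201010303012010130200104102021210031323101014030020230120101" ∷
  "030300201301010303013030010113031010130200104102021210031323114030020120" ∷
  "201030300101230120200101330130200104012021210031320101303001041020212100" ∷
  "313330020010130301030301303002011300101230120200104012021210031320200101" ∷
  "330130200104100221210031320101303001041020212100313330010130300101330130" ∷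
  "200104102021210031323313030020310101303002041020212100323331330200101404" ∷
  "002023012010103030020140101030301403001011303101013020010410202121003132" ∷
  "311404002012020103030010123012020010133013020010410022121003132010130300" ∷
  "104010221210031333002001014030103030140300201130010123012020010401022121" ∷
  "003132020010133013020010410022121003132010130300104010220211031333001014" ∷
  "030010133013020010410202121003132331403002031010130300204021221021032333" ∷
  "133010140400301202010303002013020103030010130301030301303002011300101230" ∷
  "120200104012021210031320200101330130200104100221210031320101303001041020" ∷
  "212100313330030020140201030300101403010303014030020113001012301202001040" ∷
  "120212100313202001013301302001040120202110313201013030010410202121003133" ∷
  "300200101404010303014040020113001012301202001040021212100313202001014301" ∷
  "402001040021212100313201014030010400122121003133300101404003011300101330" ∷
  "130200104102021210031320300101430140200104012021210031320101404001041020" ∷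
  "212100313430140400303102031010130300204102021210032333103002031010140300" ∷
  "204021102121032333102001014040020400212121003234310101404003032333431140" ∷
  "400301202013030010410022121003133320201303002012303202013030010410022121" ∷
  "003133320101303002013301303001041020212100313333130300201303002041002212" ∷
  "100323332330300201403002012303202013030010410022121003133320101403002013" ∷
  "301303001041020212100313333140300201303002040221210210323332330200101404" ∷
  "003012300201330130300104102021210031330300201430140300104010221210031330" ∷
  "201404001041020212100313430140400303202013030020410022121003233320300201" ∷
  "403002040211021210323332020010140400304001221210033341404003032333432010" ∷
  "140400301303002041020212100323333030020140400204012021210032340101404003" ∷
  "040102212100333414040030323334331404003032330300203132331303002013030020" ∷
  "121030120101301010303013020010113031010120200104020121210031323102013030" ∷
  "010230110101030300101301010303013020010113031010120200104021221210031323" ∷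
  "113030010130201030301302001012301202001040210212100313232010130200101430" ∷
  "140200104021021210031320101403001042010212100313330130200101403002040012" ∷
  "022110323331320101303002013103013030010230110101030300101301010303013020" ∷
  "010113031010120200104201021210031323102013010140101030301402001011303101" ∷
  "012020010421002121003132311303001014020103030140200101230120200104210021" ∷
  "210031323201014040020113001012301202001042010212100313202001014301402001" ∷
  "040211202010313201014030010421002121003133301404002031320200101403002042" ∷
  "100212100323331321303002013030020230120101030300201301010303013030010113" ∷
  "031010130200104021021210031323101013030130101030301301014020010420102121" ∷
  "003132311303002013020103030010130301030301303002011300101230120200104021" ∷
  "021210031320200101330130200104021021210031320101303001040201212100313330" ∷
  "020010133013020010143014020010402102121003132010140300104201021210031333" ∷
  "001013030010143014020010420102121003132010140400104201021210031343013030" ∷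
  "020310101403002042010212100323331020010140400204021021210032343101014040" ∷
  "030323334310200101303014010103030140400101130310101402001042100212100313" ∷
  "231130300201402010303001014030103030140300201130010123012020010401022121" ∷
  "003132020010133013020010401122021103132010130300104010221210031333002001" ∷
  "014040103030140400201130010123012020010400122121003132020010143014020010" ∷
  "401221220103132010140300104210021210031333001014040030113001013301302001" ∷
  "040112202110313203001014301402001040212122010313201014040010401022121003" ∷
  "134301404003031020310101303002040012212100323331030020310101403002042100" ∷
  "212100323331020010140400204001221210032343101014040030323334310101303001" ∷
  "014040103030140400201130010123012020010402102121003132020010143014020010" ∷
  "421002121003132010140300104210021210031333001014040010143014020010420102" ∷
  "121003132341404002031010140300204210021210032333134130300201404002012303" ∷
  "202014030010421002121003133320101404003012300201330130300104012021210031" ∷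
  "330300201430140300104020102121031330201404001040120212100313430140400303" ∷
  "202013030020402102121003233320300201403002042100212100323332020010140400" ∷
  "304210021210033341404003032333432020010140400201430140300104201021210031" ∷
  "333414040020140300204002102121032333234010140400301403002042010212100323" ∷
  "302014040020402102121003234010140400304210021210033341404003032333434140" ∷
  "400303202031323402001013030020141030140300102301101010303001013010103030" ∷
  "130200101130310101202001040021212100313231020140400102301101010303001014" ∷
  "010103030140200101130310101202001040122212100313231140400301130010130201" ∷
  "030301302001012301202001040012212100313232030010140201030301402001012301" ∷
  "202001040122212100313232010140400201130010123012020010401202121003132020" ∷
  "010143014020010401202121003132010140300104010221210031333014040020313202" ∷
  "001014030020401212002103233313213030020140300202301201010303002013010103" ∷
  "030130300101130310101302001040120122100313231010140301301010303013010140" ∷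
  "200104102012210031323114030020130201030300101303010303013030020113001012" ∷
  "301202001040121212100313202001013301302001040120122100313201013030010401" ∷
  "021221003133300200101330130200101430140200104012012210031320101403001041" ∷
  "020122100313330010130300101430140200104102012210031320101404001041020122" ∷
  "100313430130300203101014030020410201221003233310200101404002040120122100" ∷
  "323431010140400303233343102001014040030230130101030300301401010303014040" ∷
  "010113031010140200104102012210031323114040030120201030300201302010303001" ∷
  "013030103030130300201130010123012020010401122121003132020010133013020010" ∷
  "401201221003132010130300104010212210031333003002014020103030010140301030" ∷
  "301403002011300101230120200104012221210031320200101330130200104002112210" ∷
  "031320101303001040012122100313330020010140401030301404002011300101230120" ∷
  "200104011221210031320200101430140200104012002211031320101403001041020122" ∷
  "100313330010140400301130010133013020010401201221003132030010143014020010" ∷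
  "410201221003132010140400104102012210031343014040030310203101013030020402" ∷
  "112012103233310300203101014030020410201221003233310200101404002040021122" ∷
  "100323431010140400303233343101014040030130201030300101330130200101430140" ∷
  "200104100212210031320101403001040102122100313330030010140401030301404002" ∷
  "011300101230120200104012121210031320200101430140200104100212210031320101" ∷
  "403001040102022110313330010140400101430140200104102012210031323414040020" ∷
  "310101403002040212120210323331341404003013030020123032020130300104010212" ∷
  "210031333202013020140300104100212210031333201013030020143014030010410201" ∷
  "221003133020140400104102012210031343013030020140300204100212210032333202" ∷
  "001014040030401021221003334140400303233343203002014040020123032020140300" ∷
  "104100212210031333201014040030123002013301303001040102122100313303002014" ∷
  "301403001041020122100313302014040010410201221003134301404003032020130300" ∷
  "204021120121032333203002014030020410021221003233320200101404003040012122" ∷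
  "100333414040030323334320200101404002014301403001041020122100313334140400" ∷
  "201403002040221120210323332340101404003014030020410201221003233020140400" ∷
  "204012012210032340101404003040102122100333414040030323334341404003032020" ∷
  "313234010130300201404002023012010103030020140101030301403001011303101013" ∷
  "020010401202121003132310101404003023013010103030030140101030301404001011" ∷
  "303101014020010401202121003132311404003012020103030020130201030300101303" ∷
  "010303013030020113001012301202001040021212100313202001013301302001040012" ∷
  "212100313201013030010400212121003133300300201402010303001014030103030140" ∷
  "300201130010123012020010401202121003132020010133013020010401202121003132" ∷
  "010130300104010212210031333002001014040103030140400201130010123012020010" ∷
  "401202121003132020010143014020010401202121003132010140300104010221210031" ∷
  "333001014040030113001013301302001040120212100313203001014301402001040120" ∷
  "212100313201014040010401202121003134301404003031020310101303002040021212" ∷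
  "100323331030020310101403002040021122100323331020010140400204012021210032" ∷
  "343101014040030323334310200101404014010103030140101502001041020212100313" ∷
  "231140400201402010303001014030103030140300201130010123012020010401022121" ∷
  "003132020010133013020010401201221003132010130300104010221210031333002001" ∷
  "014301402001015301502001041002212100313201015030010401022121003133300101" ∷
  "403001015301502001041020212100313201015040010410202121003134301403002031" ∷
  "010150300204102012210032333102001015040020401201221003234310101504003032" ∷
  "333431010140400301402010303001014040103030140400201130010123012020010401" ∷
  "202121003132020010143014020010401202121003132010140300104010221210031333" ∷
  "003001014301402001015301502001040120212100313201015030010410202121003133" ∷
  "300101404001015301502001041020212100313201015050010410202121003135301404" ∷
  "002031010150300204102021210032333102001015050020401202121003235310101505" ∷
  "003032333531140400301403002012303202013030010401022121003133320201404002" ∷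
  "012303202014030010401022121003133320101404003012300201330130300104012021" ∷
  "210031330300201430140300104010221210031330201404001040120212100313430140" ∷
  "400303202013030020400122121003233320300201403002040012122100323332020010" ∷
  "140400304010221210033341404003032333432030020140201503001041002212100313" ∷
  "332010140300201530150300104102021210031330201504001041020212100313430140" ∷
  "300201503002041002122100323332020010150400304010212210033341504003032333" ∷
  "432020010140400201530150300104102021210031330201505001041020212100313530" ∷
  "140400201503002041002212100323332020010150500304010221210033351505003032" ∷
  "333532010140400301503002041020212100323302015040020410022121003234010150" ∷
  "400304102021210033341504003032333403002015050020401202121003235010150500" ∷
  "304010221210033351505003032333502001015050040401202121003435150500403234" ∷
  "350101505004033343530140400303202031320300203132020010150500403334353132" ∷
  "130300201404003012300201303010303013030010133013020010400122120103132330" ∷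
  "300201403010303014030010133013020010401202121003132330201404003011300101" ∷
  "330130200104012012210031320300101430140200104012002211031320101404001040" ∷
  "112212010313430140400303133030010140400204011221021032343133010140400301" ∷
  "303010303002013301303001014301402001040012122010313201014040010400121220" ∷
  "103134300300201404010303014040030113001013301302001040120202110313203001" ∷
  "014301402001040120212100313201014040010401212020103134300201404001014301" ∷
  "402001040120122100313234140400303101014040020402112002103234313414040030" ∷
  "130300201330130300104002121201031333302013030020143014030010400211220103" ∷
  "133020140400104002112201031343001013030140400104202121201031343313030020" ∷
  "140400204011022221032340101404003041010222210333414040030323334330300201" ∷
  "404003012300201330130300104002121201031330300201430140300104002112201031" ∷
  "330201404001040021212010313430010140400301330330301404001040120212100313" ∷
  "433140400301303002040021212010323333030020140400204012021210032340101404" ∷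
  "003040101222210333414040030323334330200101404003014301404001040120122100" ∷
  "313434140400301403002040021122010323302014040020401201221003234010140400" ∷
  "304010122221033341404003032333434010140400301404002040201210210323433341" ∷
  "404003031333402001014040030140301030300201404010303014040030113001013301" ∷
  "302001040012212010313203001014301402001040012122010313201014040010400122" ∷
  "120103134300300201430140300101530150200104012021210031320101504001041020" ∷
  "212100313430020140400101530150200104012012210031320101505001041020122100" ∷
  "313530140400303101015040020402112012103234310300101505002042011201210323" ∷
  "531010150500403234353114040030140300201330130300104010221210031333302014" ∷
  "040030123002013301303001040102202110313303002014301403001040102212100313" ∷
  "302014040010401122020103134300101404003013303303014040010401022121003134" ∷
  "331404003013030020400122120103233330300201404002040110222210323401014040" ∷
  "030401022121003334140400303233343303002014030020153015030010401022121003" ∷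
  "133020150400104100221210031343001014030150400104102021210031343314030020" ∷
  "150400204011022221032340101504003041010222210333415040030323334330200101" ∷
  "404003015301504001041002212100313403015050010401022121003135301404003015" ∷
  "030020411022021103233020150400204100221210032340101504003058793625410985" ∷
  "376410233341504003032333403002015050020578936254109853764012323501015050" ∷
  "030401022121003335150500303233350200101505004041102202110343515050040323" ∷
  "435010150500403334353001014040030150400204100221210032343303001015050040" ∷
  "401022121003435150500403234353314040030313303002031010150500403334353133" ∷
  "010140400301404003012300201330130300104010212210031330300201430140300104" ∷
  "010202211031330201404001040121212010313430020140400201430140300104010212" ∷
  "210031333401014040030143014040010401021221003134341404003014030020400121" ∷
  "220103233020140400204011022221032340101404003040102122100333414040030323" ∷
  "334340300201404002015301503001040102122100313302015050010410021221003135" ∷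
  "300101404003015301504001041020212100313403015050010401202121003135301404" ∷
  "003015030020411202021103233020150400205873962541098527641033234010150400" ∷
  "304102021210033341504003032333403002015050020401202121003235010150500305" ∷
  "783962541098527640133335150500303233350200101505004041120202110343515050" ∷
  "040323435010150500403334353002001014040150500104102012210031353414040020" ∷
  "150500204011022221032350101505003041010222210333515050030323335340101404" ∷
  "003015050020410021221003235010150500404010212210034351505004032343534140" ∷
  "400303102031010150500403334353134140400301404003032330300201404003040121" ∷
  "210210333432330201404003032020140400304021120021033343234010140400301404" ∷
  "003040210210210333433341404003032333403002014040030320201504003040211201" ∷
  "210333432030020150500304201120121033353202015050040333435320101404003015" ∷
  "040030410202121003334330300201505004040120212100343515050040333435331404" ∷
  "003032330300201505004033343532330200101404003015050030410201221003335020" ∷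
  "150500404012012210034351505004033343534140400303202015050040333435323401" ∷
  "01404003015050040333435333414040030323334" ∷
  [])

certificate : Certificate 0
certificate = proj₁ (from-just (parse (length cubic10Certificate) 0 cubic10Certificate))

cubic-domatic3-or-petersen : (G : Graph 10) → IsSimple G → IsCubic G →
  Σ (Fin 10 → Fin 3) (IsDomaticColouring G) ⊎ G ≅ Petersen
cubic-domatic3-or-petersen G simple cubic = sound certificate refl noLabels
  where
  open Soundness G simple cubic
  noLabels : Labelling []
  noLabels = record { vertex = λ () ; injective = λ { {()} } ; describes = λ () }

corollary3p5 : (G : Graph 10) → IsSimple G → IsCubic G → ¬ (G ≅ Petersen) →
    (∀ a b → IsDomaticNumber G a → IsDomaticNumber Petersen b → a ≢ b) ×
    (∀ a b → IsStrongDomaticNumber G a → IsStrongDomaticNumber Petersen b → a ≢ b)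
corollary3p5 G simple cubic G≇P = domatic-differ , strongDomatic-differ
  where
  colouring : Σ (Fin 10 → Fin 3) (IsDomaticColouring G)
  colouring = [ id , ⊥-elim ∘ G≇P ]′ (cubic-domatic3-or-petersen G simple cubic)
  domatic-differ : ∀ a b → IsDomaticNumber G a → IsDomaticNumber Petersen b → a ≢ b
  domatic-differ a b = domaticNumbers-differ (proj₂ colouring) petersen-noDomatic3Colouring
  strongDomatic-differ : ∀ a b → IsStrongDomaticNumber G a → IsStrongDomaticNumber Petersen b → a ≢ b
  strongDomatic-differ a b dG dP = domatic-differ a b
    (regular⇒strongDomaticNumber⇒domaticNumber cubic dG)
    (regular⇒strongDomaticNumber⇒domaticNumber petersen-cubic dP)
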